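{- Let $H$ be a Bush-type Hadamard matrix of order $v=4u^2$. Then there are at least $2^{2u}$ self-dual bent sequences for $H$.
   Context: A Hadamard matrix of order $v$ is a $v\times v$ matrix with entries $\pm1$ satisfying $HH^t=vI_v$. A Hadamard matrix of order $4u^2$ is Bush-type if it can be partitioned into a $2u\times 2u$ array of blocks $H_{ij}$, each of size $2u\times 2u$, such that each diagonal block $H_{ii}$ is the all-ones matrix and each off-diagonal block has all row sums and all column sums equal to zero. A self-dual bent sequence for $H$ is a vector $X\in\{\pm1\}^v$ with $\frac{1}{\sqrt v}HX=X$. -}

module Defs where

open import Data.Nat as ℕ using (ℕ; zero; suc)
open import Data.Integer using (ℤ; +_; -_; _+_; _*_; 0ℤ; 1ℤ)
open import Data.Fin using (Fin; combine)
open import Data.Sum using (_⊎_)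
open import Data.Product using (_×_; Σ; ∃)
open import Relation.Binary.PropositionalEquality using (_≡_; _≢_)

∑ : (n : ℕ) → (Fin n → ℤ) → ℤ
∑ zero    f = 0ℤ
∑ (suc n) f = f Fin.zero + ∑ n (λ i → f (Fin.suc i))


Matrix : ℕ → Set
Matrix v = Fin v → Fin v → ℤ

IsSign : ℤ → Set
IsSign x = (x ≡ 1ℤ) ⊎ (x ≡ - 1ℤ)

IsHadamard : (v : ℕ) → Matrix v → Set
IsHadamard v H =
  (∀ i j → IsSign (H i j)) ×
  (∀ i j → (i ≡ j → ∑ v (λ k → H i k * H j k) ≡ + v)
         × (i ≢ j → ∑ v (λ k → H i k * H j k) ≡ 0ℤ))

-- Bush-type Hadamard matrix of order 4u² = (2u)·(2u).
-- Row/column index  combine i a  (= i·2u + a) lies in block i, position a.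
IsBushType : (u : ℕ) → Matrix (2 ℕ.* u ℕ.* (2 ℕ.* u)) → Set
IsBushType u H =
  IsHadamard (2 ℕ.* u ℕ.* (2 ℕ.* u)) H ×
  ((i : Fin (2 ℕ.* u)) → ∀ a b → H (combine i a) (combine i b) ≡ 1ℤ) ×
  ((i j : Fin (2 ℕ.* u)) → i ≢ j →
     (∀ a → ∑ (2 ℕ.* u) (λ b → H (combine i a) (combine j b)) ≡ 0ℤ) ×
     (∀ b → ∑ (2 ℕ.* u) (λ a → H (combine i a) (combine j b)) ≡ 0ℤ))

-- Self-dual bent sequence for H of order v = (2u)², i.e. X ∈ {±1}^v with
-- (1/√v) H X = X, equivalently H X = 2u · X since √v = 2u.
IsSelfDualBent : (u : ℕ) → Matrix (2 ℕ.* u ℕ.* (2 ℕ.* u)) →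
                 (Fin (2 ℕ.* u ℕ.* (2 ℕ.* u)) → ℤ) → Set
IsSelfDualBent u H X =
  (∀ i → IsSign (X i)) ×
  (∀ i → ∑ (2 ℕ.* u ℕ.* (2 ℕ.* u)) (λ j → H i j * X j) ≡ + (2 ℕ.* u) * X i)

-- X is taken constant on each block of 2u coordinates. Then row (i, a) of H X
-- is a sum over blocks j of (row sum of H_{ij} in row a) · X_j, which is 2u · X_i
-- because only the all-ones diagonal block contributes. The 2^(2u) choices of
-- signs on the blocks give distinct sequences.
module Submission where

open import Defs
open import Data.Nat using (ℕ; zero; suc; _^_; _*_)
import Data.Nat as ℕ
open import Data.Fin using (Fin; combine; quotient; _↑ˡ_; _↑ʳ_; finToFun; funToFin)
open import Data.Fin.Properties
  using (suc-injective; remQuot-combine; combine-surjective; funToFin-finToFin; ¬∀⟶∃¬)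
open import Data.Integer using (ℤ; +_; -_; 0ℤ; 1ℤ) renaming (_+_ to _+ℤ_; _*_ to _*ℤ_)
import Data.Integer as ℤ
open import Data.Integer.Properties
  using (+-identityˡ; +-identityʳ; +-assoc; *-zeroˡ; *-distribʳ-+; pos-+)
open import Data.Product using (Σ; _×_; ∃; _,_; proj₁)
open import Data.Sum using (inj₁; inj₂)
open import Function using (_∘_)
open import Relation.Binary.PropositionalEquality

∑-cong : ∀ n {f g : Fin n → ℤ} → (∀ i → f i ≡ g i) → ∑ n f ≡ ∑ n g
∑-cong zero    f≗g = refl
∑-cong (suc n) f≗g = cong₂ _+ℤ_ (f≗g Fin.zero) (∑-cong n (f≗g ∘ Fin.suc))

∑-zero : ∀ n → ∑ n (λ _ → 0ℤ) ≡ 0ℤ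
∑-zero zero    = refl
∑-zero (suc n) = trans (+-identityˡ _) (∑-zero n)

∑-one : ∀ n → ∑ n (λ _ → 1ℤ) ≡ + n
∑-one zero    = refl
∑-one (suc n) = trans (cong (1ℤ +ℤ_) (∑-one n)) (sym (pos-+ 1 n))

∑-*ʳ : ∀ n (f : Fin n → ℤ) c → ∑ n (λ i → f i *ℤ c) ≡ ∑ n f *ℤ c
∑-*ʳ zero    f c = sym (*-zeroˡ c)
∑-*ʳ (suc n) f c =
  trans (cong (f Fin.zero *ℤ c +ℤ_) (∑-*ʳ n (f ∘ Fin.suc) c))
        (sym (*-distribʳ-+ c (f Fin.zero) _))

∑-↑ : ∀ m n (f : Fin (m ℕ.+ n) → ℤ) →
      ∑ (m ℕ.+ n) f ≡ ∑ m (λ i → f (i ↑ˡ n)) +ℤ ∑ n (λ j → f (m ↑ʳ j))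
∑-↑ zero    n f = sym (+-identityˡ _)
∑-↑ (suc m) n f =
  trans (cong (f Fin.zero +ℤ_) (∑-↑ m n (f ∘ Fin.suc))) (sym (+-assoc (f Fin.zero) _ _))

∑-combine : ∀ m n (f : Fin (m * n) → ℤ) →
            ∑ (m * n) f ≡ ∑ m (λ i → ∑ n (λ a → f (combine i a)))
∑-combine zero    n f = refl
∑-combine (suc m) n f =
  trans (∑-↑ n (m * n) f)
        (cong (∑ n (λ a → f (combine {suc m} Fin.zero a)) +ℤ_) (∑-combine m n (f ∘ (n ↑ʳ_))))

∑-single : ∀ n (f : Fin n → ℤ) i → (∀ j → i ≢ j → f j ≡ 0ℤ) → ∑ n f ≡ f i
∑-single (suc n) f Fin.zero f≡0 =
  trans (cong (f Fin.zero +ℤ_) (trans (∑-cong n (λ j → f≡0 (Fin.suc j) λ ())) (∑-zero n)))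
        (+-identityʳ _)
∑-single (suc n) f (Fin.suc i) f≡0 =
  trans (cong₂ _+ℤ_ (f≡0 Fin.zero λ ())
                    (∑-single n (f ∘ Fin.suc) i λ j i≢j → f≡0 (Fin.suc j) (i≢j ∘ suc-injective)))
        (+-identityˡ _)

blockConstant : ∀ {m} n → (Fin m → ℤ) → Fin (m * n) → ℤ
blockConstant n s = s ∘ quotient n

blockConstant-combine : ∀ {m n} (s : Fin m → ℤ) i a → blockConstant n s (combine i a) ≡ s i
blockConstant-combine s i a = cong (s ∘ proj₁) (remQuot-combine i a)

blockConstant-distinct : ∀ {m n} {s t : Fin m → ℤ} → Fin n →
  (∃ λ i → s i ≢ t i) → ∃ λ x → blockConstant n s x ≢ blockConstant n t x
blockConstant-distinct {s = s} {t} a (i , sᵢ≢tᵢ) = combine i a , λ same →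
  sᵢ≢tᵢ (trans (sym (blockConstant-combine s i a)) (trans same (blockConstant-combine t i a)))

blockConstant-eigenvector :
  ∀ m n (M : Matrix (m * n)) →
  (∀ i a b → M (combine i a) (combine i b) ≡ 1ℤ) →
  (∀ i j → i ≢ j → ∀ a → ∑ n (λ b → M (combine i a) (combine j b)) ≡ 0ℤ) →
  ∀ s x → ∑ (m * n) (λ y → M x y *ℤ blockConstant n s y) ≡ + n *ℤ blockConstant n s x
blockConstant-eigenvector m n M diagonal offDiagonal s x
  with combine-surjective {m} {n} x
... | i , a , refl = begin
  ∑ (m * n) (λ y → M (combine i a) y *ℤ blockConstant n s y)
    ≡⟨ ∑-combine m n _ ⟩
  ∑ m (λ j → ∑ n (λ b → M (combine i a) (combine j b) *ℤ blockConstant n s (combine j b)))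
    ≡⟨ ∑-cong m (λ j → ∑-cong n (λ b →
         cong (M (combine i a) (combine j b) *ℤ_) (blockConstant-combine s j b))) ⟩
  ∑ m (λ j → ∑ n (λ b → M (combine i a) (combine j b) *ℤ s j))
    ≡⟨ ∑-cong m (λ j → ∑-*ʳ n _ (s j)) ⟩
  ∑ m (λ j → rowSum j *ℤ s j)
    ≡⟨ ∑-single m _ i (λ j i≢j → trans (cong (_*ℤ s j) (offDiagonal i j i≢j a)) (*-zeroˡ (s j))) ⟩
  rowSum i *ℤ s i
    ≡⟨ cong (_*ℤ s i) (trans (∑-cong n (diagonal i a)) (∑-one n)) ⟩
  + n *ℤ s i
    ≡⟨ cong (+ n *ℤ_) (blockConstant-combine s i a) ⟨
  + n *ℤ blockConstant n s (combine i a) ∎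
  where
  open ≡-Reasoning
  rowSum : Fin m → ℤ
  rowSum j = ∑ n (λ b → M (combine i a) (combine j b))

sign : Fin 2 → ℤ
sign Fin.zero    = 1ℤ
sign (Fin.suc _) = - 1ℤ

sign-isSign : ∀ b → IsSign (sign b)
sign-isSign Fin.zero           = inj₁ refl
sign-isSign (Fin.suc Fin.zero) = inj₂ refl

sign-injective : ∀ b c → sign b ≡ sign c → b ≡ c
sign-injective Fin.zero           Fin.zero           _  = refl
sign-injective Fin.zero           (Fin.suc Fin.zero) ()
sign-injective (Fin.suc Fin.zero) Fin.zero           ()
sign-injective (Fin.suc Fin.zero) (Fin.suc Fin.zero) _  = refl

funToFin-cong : ∀ {m n} {f g : Fin m → Fin n} → (∀ i → f i ≡ g i) → funToFin f ≡ funToFin g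
funToFin-cong {zero}  f≗g = refl
funToFin-cong {suc m} f≗g = cong₂ combine (f≗g Fin.zero) (funToFin-cong (f≗g ∘ Fin.suc))

finToFun-injective : ∀ m n {k l : Fin (m ^ n)} → (∀ i → finToFun k i ≡ finToFun l i) → k ≡ l
finToFun-injective m n {k} {l} k≗l =
  trans (sym (funToFin-finToFin {n} {m} k))
        (trans (funToFin-cong {n} {m} k≗l) (funToFin-finToFin {n} {m} l))

signVector : ∀ n → Fin (2 ^ n) → Fin n → ℤ
signVector n k = sign ∘ finToFun {2} {n} k

signVector-isSign : ∀ n k i → IsSign (signVector n k i)
signVector-isSign n k i = sign-isSign (finToFun {2} {n} k i)

signVector-distinct : ∀ n {k l : Fin (2 ^ n)} → k ≢ l → ∃ λ i → signVector n k i ≢ signVector n l i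
signVector-distinct n {k} {l} k≢l =
  ¬∀⟶∃¬ n (λ i → signVector n k i ≡ signVector n l i) (λ i → signVector n k i ℤ.≟ signVector n l i)
    (λ k≗l → k≢l (finToFun-injective 2 n λ i → sign-injective _ _ (k≗l i)))

mainTheorem8 : (u : ℕ) (H : Matrix (2 * u * (2 * u))) → IsBushType u H →
    Σ (Fin (2 ^ (2 * u)) → Fin (2 * u * (2 * u)) → ℤ) λ X →
      (∀ k → IsSelfDualBent u H (X k)) ×
      (∀ k l → k ≢ l → ∃ λ i → X k i ≢ X l i)
mainTheorem8 u H (_ , diagonal , offDiagonal) = X , selfDualBent , distinct
  where
  X : Fin (2 ^ (2 * u)) → Fin (2 * u * (2 * u)) → ℤ
  X k = blockConstant (2 * u) (signVector (2 * u) k)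

  selfDualBent : ∀ k → IsSelfDualBent u H (X k)
  selfDualBent k =
    signVector-isSign (2 * u) k ∘ quotient (2 * u) ,
    blockConstant-eigenvector (2 * u) (2 * u) H diagonal
      (λ i j i≢j → proj₁ (offDiagonal i j i≢j)) (signVector (2 * u) k)

  distinct : ∀ k l → k ≢ l → ∃ λ x → X k x ≢ X l x
  distinct k l k≢l with signVector-distinct (2 * u) k≢l
  ... | i , differ = blockConstant-distinct {s = signVector (2 * u) k} i (i , differ)
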